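{- For every positive integer $k$, let $A_k$ be the graph constructed as follows: take a star $K_{1,2^k}$ with center $c$, whose leaves are labeled bijectively by the binary strings of length $k$; add $k$ new vertices $u_1,\dots,u_k$, where $u_i$ is adjacent to exactly the leaves whose label has $0$ in the $i$-th digit; add all edges $u_iu_j$ for $1\le i<j\le k$; and delete the leaf labeled by the all-$1$ string. Then $\textnormal{adim}(A_k)=k$ and $\textnormal{ftadim}(A_k)\ge 2^{k-1}$.
   Context: Graphs are finite, simple, undirected. A set $S=\{v_1,\dots,v_k\}$ of vertices is an adjacency resolving set of $G$ if the vectors $(\min(2,\textnormal{dist}(u,v_1)),\dots,\min(2,\textnormal{dist}(u,v_k)))$ are pairwise distinct over $u\in V(G)$. $\textnormal{adim}(G)$ is the minimum size of an adjacency resolving set; $\textnormal{ftadim}(G)$ is the minimum size of a nonempty $S\subseteq V(G)$ such that $S-\{s\}$ is an adjacency resolving set for every $s\in S$. -}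

module Defs where

open import Data.Nat using (ℕ; zero; suc; _≤_)
open import Data.Bool using (Bool; true; false; not; _∧_; T; if_then_else_)
open import Data.Bool.Properties using (T-irrelevant) renaming (_≟_ to _≟B_)
open import Data.Fin using (Fin)
open import Data.Fin.Properties using () renaming (_≟_ to _≟F_)
open import Data.Vec using (Vec; []; _∷_; lookup)
open import Data.Vec.Properties using (≡-dec)
open import Data.List using (List; []; map; filter; length)
open import Data.List.Membership.Propositional using (_∈_)
open import Data.List.Relation.Unary.Unique.Propositional using (Unique)
open import Data.Product using (Σ; _×_; _,_)
open import Relation.Nullary using (¬_; Dec; yes; no; ¬?)
open import Relation.Nullary.Decidable using (⌊_⌋)
open import Relation.Binary.Definitions using (DecidableEquality)
open import Relation.Binary.PropositionalEquality using (_≡_; _≢_; refl; sym; cong)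

record Graph : Set₁ where
  field
    V         : Set
    _≟_       : DecidableEquality V
    adj       : V → V → Bool
    adj-sym   : ∀ u v → adj u v ≡ adj v u
    adj-irref : ∀ v → adj v v ≡ false

module _ (G : Graph) where
  open Graph G

  -- min(2, dist(u,v)): 0 if u = v, 1 if adjacent, 2 otherwise
  -- (distance ≥ 2 or infinite).
  dist2 : V → V → ℕ
  dist2 u v = if ⌊ u ≟ v ⌋ then 0 else (if adj u v then 1 else 2)

  -- A vertex set is a duplicate-free list of vertices; its size is its length.
  -- Adjacency representation of u with respect to S = (v₁,…,v_k).
  adjRep : List V → V → List ℕ
  adjRep S u = map (dist2 u) S

  IsAdjResolving : List V → Set
  IsAdjResolving S = ∀ u v → adjRep S u ≡ adjRep S v → u ≡ v

  remove : V → List V → List V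
  remove s S = filter (λ x → ¬? (x ≟ s)) S

  IsFTAdjResolving : List V → Set
  IsFTAdjResolving S = S ≢ [] × (∀ s → s ∈ S → IsAdjResolving (remove s S))

  IsAdim : ℕ → Set
  IsAdim m =
    Σ (List V) (λ S → Unique S × IsAdjResolving S × length S ≡ m)
    × (∀ S → Unique S → IsAdjResolving S → m ≤ length S)

  IsFtadim : ℕ → Set
  IsFtadim m =
    Σ (List V) (λ S → Unique S × IsFTAdjResolving S × length S ≡ m)
    × (∀ S → Unique S → IsFTAdjResolving S → m ≤ length S)

-- The graph A_k.  Binary digit 0 is `false`, 1 is `true`.

allOnes : ∀ {k} → Vec Bool k → Bool
allOnes []       = true
allOnes (b ∷ bs) = b ∧ allOnes bs

data AV (k : ℕ) : Set where
  center : AV k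
  -- leaf labelled by w, the all-1 leaf being deleted
  leaf   : (w : Vec Bool k) → T (not (allOnes w)) → AV k
  -- u_i  (i ∈ Fin k stands for index i+1)
  hub    : Fin k → AV k

AV-≟ : ∀ {k} → DecidableEquality (AV k)
AV-≟ center center = yes refl
AV-≟ center (leaf _ _) = no λ ()
AV-≟ center (hub _) = no λ ()
AV-≟ (leaf _ _) center = no λ ()
AV-≟ (leaf w p) (leaf w′ p′) with ≡-dec _≟B_ w w′
... | yes refl = yes (cong (leaf w) (T-irrelevant p p′))
... | no ne = no λ { refl → ne refl }
AV-≟ (leaf _ _) (hub _) = no λ ()
AV-≟ (hub _) center = no λ ()
AV-≟ (hub _) (leaf _ _) = no λ ()
AV-≟ (hub i) (hub j) with i ≟F j
... | yes refl = yes refl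
... | no ne = no λ { refl → ne refl }

A-adj : ∀ {k} → AV k → AV k → Bool
A-adj center     (leaf _ _) = true
A-adj (leaf _ _) center     = true
A-adj (hub i)    (leaf w _) = not (lookup w i)
A-adj (leaf w _) (hub i)    = not (lookup w i)
A-adj (hub i)    (hub j)    = not ⌊ i ≟F j ⌋
A-adj _          _          = false

private
  ⌊≟F⌋-sym : ∀ {k} (i j : Fin k) → ⌊ i ≟F j ⌋ ≡ ⌊ j ≟F i ⌋
  ⌊≟F⌋-sym i j with i ≟F j | j ≟F i
  ... | yes _ | yes _ = refl
  ... | yes refl | no ne = Data.Empty.⊥-elim (ne refl)
    where import Data.Empty
  ... | no ne | yes refl = Data.Empty.⊥-elim (ne refl)
    where import Data.Empty
  ... | no _ | no _ = refl

  ⌊≟F⌋-refl : ∀ {k} (i : Fin k) → ⌊ i ≟F i ⌋ ≡ true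
  ⌊≟F⌋-refl i with i ≟F i
  ... | yes _ = refl
  ... | no ne = Data.Empty.⊥-elim (ne refl)
    where import Data.Empty

A-adj-sym : ∀ {k} (u v : AV k) → A-adj u v ≡ A-adj v u
A-adj-sym center center = refl
A-adj-sym center (leaf _ _) = refl
A-adj-sym center (hub _) = refl
A-adj-sym (leaf _ _) center = refl
A-adj-sym (leaf _ _) (leaf _ _) = refl
A-adj-sym (leaf _ _) (hub _) = refl
A-adj-sym (hub _) center = refl
A-adj-sym (hub _) (leaf _ _) = refl
A-adj-sym (hub i) (hub j) = cong not (⌊≟F⌋-sym i j)

A-adj-irref : ∀ {k} (v : AV k) → A-adj v v ≡ false
A-adj-irref center = refl
A-adj-irref (leaf _ _) = refl
A-adj-irref (hub i) = cong not (⌊≟F⌋-refl i)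

A : ℕ → Graph
A k = record
  { V         = AV k
  ; _≟_       = AV-≟
  ; adj       = A-adj
  ; adj-sym   = A-adj-sym
  ; adj-irref = A-adj-irref
  }

-- The hubs u_1, …, u_k resolve A_k: u_i is the only vertex at distance 0 from itself, a leaf
-- is at distance 1 from u_i exactly when its label has a 0 in digit i, and the center, at
-- distance 2 from every u_i, looks like the deleted all-ones leaf. Conversely, the vertices
-- outside a resolving set S get distinct representations in {1,2}^|S|, so 2^k + k ≤ |S| + 2^|S|,
-- which forces |S| ≥ k.
--
-- For a word w of length k - 1 other than 1…1, the leaves 0w and 1w are separated only by u_1
-- and by themselves, while a fault-tolerant set must separate every pair of vertices twice.
-- So a fault-tolerant set containing u_1 meets each of these 2^(k-1) - 1 pairs, and one avoiding
-- u_1 contains all of them; either way it has at least 2^(k-1) elements. A minimum exists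
-- because A_k is finite and its whole vertex set is fault-tolerant.

module Submission where

open import Defs
open import Data.Bool using (Bool; true; false; not; T; if_then_else_)
open import Data.Bool.Properties using (T-irrelevant)
open import Data.Empty using (⊥; ⊥-elim)
open import Data.Fin using () renaming (zero to fzero; suc to fsuc)
open import Data.List using (List; []; _∷_; [_]; map; length; _++_; allFin; cartesianProductWith)
open import Data.List.Properties using (length-map; length-++; length-tabulate; length-removeAt′; map-cong-local; ∷-injective) renaming (≡-dec to ≡-decᴸ)
open import Data.List.Membership.Propositional using (_∈_; _∉_; find; lose)
open import Data.List.Membership.Propositional.Properties using (∈-map⁺; ∈-map⁻; ∈-++⁺ˡ; ∈-++⁺ʳ; ∈-filter⁺; ∈-filter⁻; ∈-allFin; ∈-cartesianProductWith⁺; ∈-cartesianProductWith⁻)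
open import Data.List.Relation.Binary.Subset.Propositional using (_⊆_)
open import Data.List.Relation.Binary.Disjoint.Propositional using (Disjoint)
open import Data.List.Relation.Unary.All as All using (All; all?)
open import Data.List.Relation.Unary.AllPairs using ([]; _∷_)
import Data.List.Relation.Unary.All.Properties as All
open import Data.List.Relation.Unary.Any using (Any; here; there; any?; _─_)
open import Data.List.Relation.Unary.Unique.Propositional using (Unique)
open import Data.List.Relation.Unary.Unique.Propositional.Properties using (map⁺; ++⁺; allFin⁺)
open import Data.Nat using (ℕ; zero; suc; _+_; _*_; _^_; _≤_; _<_; _∸_; z≤n; s≤s)
open import Data.Nat.Induction using (<-rec)
open import Data.Nat.Properties using (≮⇒≥; anyUpTo?; +-comm; +-suc; +-identityʳ; +-mono-<-≤; ^-monoʳ-≤; <⇒≤; ≤-<-trans; <-irrefl; module ≤-Reasoning) renaming (_≟_ to _≟ℕ_)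
open import Data.Product using (Σ; ∃; _×_; _,_; proj₁; proj₂; uncurry)
open import Data.Vec using (Vec; lookup; replicate) renaming ([] to []ᵛ; _∷_ to _∷ᵛ_)
open import Data.Vec.Properties using (tabulate∘lookup; tabulate-cong) renaming (∷-injectiveʳ to ∷-injectiveʳᵛ)
open import Function using (_∘_; case_of_)
open import Function.Definitions using (Injective)
open import Relation.Nullary using (Dec; yes; no; ¬?; _×-dec_; contradiction)
open import Relation.Nullary.Decidable using (map′; decidable-stable; isYes≗does; dec-true; dec-false; _→-dec_)
open import Relation.Binary.PropositionalEquality using (_≡_; _≢_; refl; sym; trans; cong; cong₂; subst; module ≡-Reasoning)

private
  variable
    X Y : Set
    x y e : X
    xs ys : List X

-- Lists and natural numbers

∈-─⁺ : (p : x ∈ ys) → y ∈ ys → y ≢ x → y ∈ (ys ─ p)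
∈-─⁺ (here refl) (here refl) y≢x = contradiction refl y≢x
∈-─⁺ (here _)    (there q)   _   = q
∈-─⁺ (there _)   (here y≡z)  _   = here y≡z
∈-─⁺ (there p)   (there q)   y≢x = there (∈-─⁺ p q y≢x)

Unique-⊆⇒length≤ : Unique xs → xs ⊆ ys → length xs ≤ length ys
Unique-⊆⇒length≤ []             _     = z≤n
Unique-⊆⇒length≤ {xs = x ∷ xs} {ys = ys} (x∉xs ∷ xs!) xs⊆ys = begin
  suc (length xs)          ≤⟨ s≤s (Unique-⊆⇒length≤ xs! xs⊆ys─x) ⟩
  suc (length (ys ─ x∈ys)) ≡⟨ length-removeAt′ ys _ ⟨
  length ys                ∎
  where
  open ≤-Reasoning
  x∈ys : x ∈ ys
  x∈ys = xs⊆ys (here refl)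
  xs⊆ys─x : xs ⊆ (ys ─ x∈ys)
  xs⊆ys─x y∈xs = ∈-─⁺ x∈ys (xs⊆ys (there y∈xs)) (λ { refl → All.lookup x∉xs y∈xs refl })

∈∧∉⇒≢ : x ∈ xs → y ∉ xs → x ≢ y
∈∧∉⇒≢ x∈xs y∉xs refl = y∉xs x∈xs

map-cong-local⁻ : {f g : X → Y} → map f xs ≡ map g xs → x ∈ xs → f x ≡ g x
map-cong-local⁻ {xs = _ ∷ _} fxs≡gxs (here refl) = proj₁ (∷-injective fxs≡gxs)
map-cong-local⁻ {xs = _ ∷ _} fxs≡gxs (there x∈xs) = map-cong-local⁻ (proj₂ (∷-injective fxs≡gxs)) x∈xs

module _ {Z : Set} {f : X → Z} {g : Y → Z} {xs : List X} {ys : List Y} where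

  map-++-map⁺ : Injective _≡_ _≡_ f → Injective _≡_ _≡_ g → (∀ x y → f x ≢ g y) →
                Unique xs → Unique ys → Unique (map f xs ++ map g ys)
  map-++-map⁺ f-inj g-inj f≢g xs! ys! = ++⁺ (map⁺ f-inj xs!) (map⁺ g-inj ys!) disjoint
    where
    disjoint : Disjoint (map f xs) (map g ys)
    disjoint (z∈fxs , z∈gys) with ∈-map⁻ f z∈fxs | ∈-map⁻ g z∈gys
    ... | x , _ , refl | y , _ , fx≡gy = f≢g x y fx≡gy

length-map-++-map : ∀ {Z : Set} (f : X → Z) xs (g : Y → Z) ys →
                    length (map f xs ++ map g ys) ≡ length xs + length ys
length-map-++-map f xs g ys = trans (length-++ (map f xs)) (cong₂ _+_ (length-map f xs) (length-map g ys))

∷-map⁺ : {g : X → Y} → Injective _≡_ _≡_ g → (∀ x → e ≢ g x) → Unique xs → Unique (e ∷ map g xs)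
∷-map⁺ {g = g} g-inj e≢g xs! = All.tabulate e∉ ∷ map⁺ g-inj xs!
  where
  e∉ : ∀ {z} → z ∈ map g _ → _ ≢ z
  e∉ z∈gxs with ∈-map⁻ g z∈gxs
  ... | x , _ , refl = e≢g x

words : List X → ℕ → List (List X)
words xs zero    = [ [] ]
words xs (suc m) = cartesianProductWith _∷_ xs (words xs m)

∈-words⁺ : All (_∈ xs) ys → ys ∈ words xs (length ys)
∈-words⁺ All.[]           = here refl
∈-words⁺ (y∈xs All.∷ ys∈) = ∈-cartesianProductWith⁺ _∷_ y∈xs (∈-words⁺ ys∈)

∈-words⁻ : ∀ m → ys ∈ words xs m → length ys ≡ m
∈-words⁻ zero    (here refl) = refl
∈-words⁻ {xs = xs} (suc m) ys∈ with ∈-cartesianProductWith⁻ _∷_ xs (words xs m) ys∈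
... | _ , _ , _ , zs∈ , refl = cong suc (∈-words⁻ m zs∈)

length-cartesianProductWith : ∀ {Z : Set} (f : X → Y → Z) xs ys →
  length (cartesianProductWith f xs ys) ≡ length xs * length ys
length-cartesianProductWith f []       ys = refl
length-cartesianProductWith f (x ∷ xs) ys = begin
  length (map (f x) ys ++ cartesianProductWith f xs ys)      ≡⟨ length-++ (map (f x) ys) ⟩
  length (map (f x) ys) + length (cartesianProductWith f xs ys)
    ≡⟨ cong₂ _+_ (length-map (f x) ys) (length-cartesianProductWith f xs ys) ⟩
  length ys + length xs * length ys                          ∎
  where open ≡-Reasoning

length-words : ∀ (xs : List X) m → length (words xs m) ≡ length xs ^ m
length-words xs zero    = refl
length-words xs (suc m) = trans (length-cartesianProductWith _∷_ xs (words xs m)) (cong (length xs *_) (length-words xs m))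

Least : (ℕ → Set) → Set
Least P = ∃ λ m → P m × (∀ k → P k → m ≤ k)

least : {P : ℕ → Set} → (∀ n → Dec (P n)) → ∀ n → P n → Least P
least {P} P? = <-rec (λ n → P n → Least P) step
  where
  step : ∀ n → (∀ {m} → m < n → P m → Least P) → P n → Least P
  step n below Pn with anyUpTo? P? n
  ... | yes (m , m<n , Pm) = below m<n Pm
  ... | no  none           = n , Pn , λ k Pk → ≮⇒≥ λ k<n → none (k , k<n , Pk)

2^n+n≤m+2^m⇒n≤m : ∀ {m n} → 2 ^ n + n ≤ m + 2 ^ m → n ≤ m
2^n+n≤m+2^m⇒n≤m {m} {n} bound = ≮⇒≥ λ m<n →
  <-irrefl refl (≤-<-trans bound
    (subst (m + 2 ^ m <_) (+-comm n (2 ^ n)) (+-mono-<-≤ m<n (^-monoʳ-≤ 2 (<⇒≤ m<n)))))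

-- Finite graphs

record Enumeration (X : Set) : Set where
  field
    elements : List X
    unique   : Unique elements
    complete : ∀ x → x ∈ elements

module GraphProperties (G : Graph) where
  open Graph G
  open import Data.List.Membership.DecPropositional _≟_ using (_∈?_)
  open import Data.List.Relation.Unary.Unique.DecPropositional _≟_ using (unique?)

  dist2-self : ∀ u → dist2 G u u ≡ 0
  dist2-self u = cong (λ b → if b then 0 else (if adj u u then 1 else 2))
                      (trans (isYes≗does (u ≟ u)) (dec-true (u ≟ u) refl))

  dist2-≢ : ∀ {u v} → u ≢ v → dist2 G u v ≡ (if adj u v then 1 else 2)
  dist2-≢ {u} {v} u≢v = cong (λ b → if b then 0 else (if adj u v then 1 else 2))
                             (trans (isYes≗does (u ≟ v)) (dec-false (u ≟ v) u≢v))

  dist2-≢-∈-[1,2] : ∀ {u v} → u ≢ v → dist2 G u v ∈ 1 ∷ 2 ∷ []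
  dist2-≢-∈-[1,2] {u} {v} u≢v rewrite dist2-≢ u≢v with adj u v
  ... | true  = here refl
  ... | false = there (here refl)

  dist2≡0⇒≡ : ∀ {u v} → dist2 G u v ≡ 0 → u ≡ v
  dist2≡0⇒≡ {u} {v} d≡0 = decidable-stable (u ≟ v) λ u≢v →
    0∉[1,2] (subst (_∈ 1 ∷ 2 ∷ []) d≡0 (dist2-≢-∈-[1,2] u≢v))
    where
    0∉[1,2] : 0 ∉ 1 ∷ 2 ∷ []
    0∉[1,2] (there (there ()))

  adjRep-cong : ∀ {T u v} → (∀ {x} → x ∈ T → dist2 G u x ≡ dist2 G v x) → adjRep G T u ≡ adjRep G T v
  adjRep-cong agree = map-cong-local (All.tabulate agree)

  ∈-separates : ∀ {T u v} → u ∈ T → adjRep G T u ≡ adjRep G T v → u ≡ v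
  ∈-separates u∈T rep≡ = sym (dist2≡0⇒≡ (trans (sym (map-cong-local⁻ rep≡ u∈T)) (dist2-self _)))

  remove-resolving : ∀ {S} s → (∀ x → x ∈ S) → IsAdjResolving G (remove G s S)
  remove-resolving s complete u v rep≡ with u ≟ s | v ≟ s
  ... | no u≢s   | _        = ∈-separates (∈-filter⁺ _ (complete u) u≢s) rep≡
  ... | _        | no v≢s   = sym (∈-separates (∈-filter⁺ _ (complete v) v≢s) (sym rep≡))
  ... | yes refl | yes refl = refl

  ft-separator : ∀ {S s u v} → IsFTAdjResolving G S → s ∈ S → u ≢ v →
                 (∀ {x} → x ∈ S → x ≢ s → dist2 G u x ≡ dist2 G v x) → ⊥
  ft-separator (_ , ft) s∈S u≢v agree =
    u≢v (ft _ s∈S _ _ (adjRep-cong (uncurry agree ∘ ∈-filter⁻ _)))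

  ft-no-sole-separator : ∀ {S u v} → IsFTAdjResolving G S → u ≢ v → ∀ s →
                         (∀ {x} → x ∈ S → x ≢ s → dist2 G u x ≡ dist2 G v x) → ⊥
  ft-no-sole-separator {[]}    (S≢[] , _) _ _ _ = S≢[] refl
  ft-no-sole-separator {y ∷ S} ft u≢v s agree with s ∈? y ∷ S
  ... | yes s∈S = ft-separator ft s∈S u≢v agree
  ... | no  s∉S = ft-separator ft (here refl) u≢v λ x∈S _ → agree x∈S (∈∧∉⇒≢ x∈S s∉S)

  HasFTSetOfSize : ℕ → Set
  HasFTSetOfSize m = Σ (List V) λ S → Unique S × IsFTAdjResolving G S × length S ≡ m

  module _ (E : Enumeration V) where
    open Enumeration E

    resolving? : ∀ S → Dec (IsAdjResolving G S)
    resolving? S =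
      map′ (λ a u v → All.lookup (All.lookup a (complete u)) (complete v))
           (λ resolving → All.tabulate λ _ → All.tabulate λ _ → resolving _ _)
           (all? (λ u → all? (λ v → ≡-decᴸ _≟ℕ_ (adjRep G S u) (adjRep G S v) →-dec u ≟ v) elements)
                 elements)

    ftResolving? : ∀ S → Dec (IsFTAdjResolving G S)
    ftResolving? S =
      ¬? (≡-decᴸ _≟_ S []) ×-dec
      map′ (λ a _ → All.lookup a) (λ ft → All.tabulate (ft _)) (all? (λ s → resolving? (remove G s S)) S)

    hasFTSetOfSize? : ∀ m → Dec (HasFTSetOfSize m)
    hasFTSetOfSize? m = map′ fromAny toAny (any? (λ S → unique? S ×-dec ftResolving? S) (words elements m))
      where
      UniqueFT : List V → Set
      UniqueFT S = Unique S × IsFTAdjResolving G S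
      fromAny : Any UniqueFT (words elements m) → HasFTSetOfSize m
      fromAny a = let S , S∈ , S! , ft = find a in S , S! , ft , ∈-words⁻ m S∈
      toAny : HasFTSetOfSize m → Any UniqueFT (words elements m)
      toAny (S , S! , ft , refl) = lose (∈-words⁺ (All.tabulate λ {x} _ → complete x)) (S! , ft)

    elements-ftResolving : V → IsFTAdjResolving G elements
    elements-ftResolving v = (λ elements≡[] → case subst (v ∈_) elements≡[] (complete v) of λ ()) ,
                             λ s _ → remove-resolving s complete

    ftadim-exists : V → ∃ λ m → IsFtadim G m
    ftadim-exists v =
      let m , witness , minimal = least hasFTSetOfSize? _ (elements , unique , elements-ftResolving v , refl)
      in  m , witness , λ S S! ft → minimal (length S) (S , S! , ft , refl)

    size-bound : ∀ {S} → IsAdjResolving G S → length elements ≤ length S + 2 ^ length S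
    size-bound {S} resolving = begin
      length elements                                               ≡⟨ length-map (adjRep G S) elements ⟨
      length (map (adjRep G S) elements)
        ≤⟨ Unique-⊆⇒length≤ (map⁺ (resolving _ _) unique) reps⊆ ⟩
      length (map (adjRep G S) S ++ words codes (length S))         ≡⟨ length-++ (map (adjRep G S) S) ⟩
      length (map (adjRep G S) S) + length (words codes (length S))
        ≡⟨ cong₂ _+_ (length-map _ S) (length-words codes (length S)) ⟩
      length S + 2 ^ length S                                       ∎
      where
      open ≤-Reasoning
      codes : List ℕ
      codes = 1 ∷ 2 ∷ []
      reps⊆ : map (adjRep G S) elements ⊆ map (adjRep G S) S ++ words codes (length S)
      reps⊆ r∈ with ∈-map⁻ (adjRep G S) r∈
      ... | u , _ , refl with u ∈? S
      ... | yes u∈S = ∈-++⁺ˡ (∈-map⁺ (adjRep G S) u∈S)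
      ... | no  u∉S = ∈-++⁺ʳ _ (subst (λ m → adjRep G S u ∈ words codes m) (length-map _ S)
                        (∈-words⁺ (All.map⁺ (All.tabulate λ x∈S → dist2-≢-∈-[1,2] λ { refl → u∉S x∈S }))))

open GraphProperties

-- The graph A_k

Valid : ℕ → Set
Valid n = Σ (Vec Bool n) λ w → T (not (allOnes w))

valid-≡ : ∀ {n} {v v′ : Valid n} → proj₁ v ≡ proj₁ v′ → v ≡ v′
valid-≡ {v = w , p} {.w , p′} refl = cong (w ,_) (T-irrelevant p p′)

leafAt : ∀ {n} → Valid n → AV n
leafAt (w , p) = leaf w p

leafAt-injective : ∀ {n} → Injective _≡_ _≡_ (leafAt {n})
leafAt-injective {x = _ , _} {_ , _} refl = refl

0∷_ : ∀ {n} → Vec Bool n → Valid (suc n)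
0∷ w = false ∷ᵛ w , _

1∷_ : ∀ {n} → Valid n → Valid (suc n)
1∷ (w , p) = true ∷ᵛ w , p

vecs : ∀ n → List (Vec Bool n)
vecs zero    = [ []ᵛ ]
vecs (suc n) = map (false ∷ᵛ_) (vecs n) ++ map (true ∷ᵛ_) (vecs n)

valids : ∀ n → List (Valid n)
valids zero    = []
valids (suc n) = map 0∷_ (vecs n) ++ map 1∷_ (valids n)

vecs-complete : ∀ {n} (w : Vec Bool n) → w ∈ vecs n
vecs-complete []ᵛ          = here refl
vecs-complete (false ∷ᵛ w) = ∈-++⁺ˡ (∈-map⁺ _ (vecs-complete w))
vecs-complete (true ∷ᵛ w)  = ∈-++⁺ʳ _ (∈-map⁺ _ (vecs-complete w))

valids-complete : ∀ {n} (v : Valid n) → v ∈ valids n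
valids-complete ([]ᵛ , ())
valids-complete (false ∷ᵛ w , _) = ∈-++⁺ˡ (∈-map⁺ 0∷_ (vecs-complete w))
valids-complete (true ∷ᵛ w , p)  = ∈-++⁺ʳ _ (∈-map⁺ 1∷_ (valids-complete (w , p)))

vecs-unique : ∀ n → Unique (vecs n)
vecs-unique zero    = All.[] ∷ []
vecs-unique (suc n) =
  map-++-map⁺ ∷-injectiveʳᵛ ∷-injectiveʳᵛ (λ _ _ ()) (vecs-unique n) (vecs-unique n)

valids-unique : ∀ n → Unique (valids n)
valids-unique zero    = []
valids-unique (suc n) =
  map-++-map⁺ (∷-injectiveʳᵛ ∘ cong proj₁) (valid-≡ ∘ ∷-injectiveʳᵛ ∘ cong proj₁) (λ _ _ ())
              (vecs-unique n) (valids-unique n)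

length-vecs : ∀ n → length (vecs n) ≡ 2 ^ n
length-vecs zero    = refl
length-vecs (suc n) = begin
  length (vecs (suc n))             ≡⟨ length-map-++-map _ (vecs n) _ (vecs n) ⟩
  length (vecs n) + length (vecs n) ≡⟨ cong (λ m → m + m) (length-vecs n) ⟩
  2 ^ n + 2 ^ n                     ≡⟨ cong (2 ^ n +_) (+-identityʳ (2 ^ n)) ⟨
  2 ^ suc n                         ∎
  where open ≡-Reasoning

suc-length-valids : ∀ n → suc (length (valids n)) ≡ 2 ^ n
suc-length-valids zero    = refl
suc-length-valids (suc n) = begin
  suc (length (valids (suc n)))             ≡⟨ cong suc (length-map-++-map 0∷_ (vecs n) 1∷_ (valids n)) ⟩
  suc (length (vecs n) + length (valids n)) ≡⟨ +-suc (length (vecs n)) (length (valids n)) ⟨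
  length (vecs n) + suc (length (valids n)) ≡⟨ cong₂ _+_ (length-vecs n) (suc-length-valids n) ⟩
  2 ^ n + 2 ^ n                             ≡⟨ cong (2 ^ n +_) (+-identityʳ (2 ^ n)) ⟨
  2 ^ suc n                                 ∎
  where open ≡-Reasoning

hubs : ∀ n → List (AV n)
hubs n = map hub (allFin n)

∈-hubs : ∀ {n} i → hub i ∈ hubs n
∈-hubs i = ∈-map⁺ hub (∈-allFin i)

length-hubs : ∀ n → length (hubs n) ≡ n
length-hubs n = trans (length-map hub (allFin n)) (length-tabulate (λ i → i))

hubs-unique : ∀ n → Unique (hubs n)
hubs-unique n = map⁺ (λ { refl → refl }) (allFin⁺ n)

vertices : ∀ n → Enumeration (AV n)
vertices n = record
  { elements = center ∷ map leafAt (valids n) ++ hubs n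
  ; unique   = All.++⁺ (All.map⁺ {f = leafAt} (All.universal (λ _ ()) (valids n)))
                       (All.map⁺ {f = hub} (All.universal (λ _ ()) (allFin n)))
             ∷ map-++-map⁺ leafAt-injective (λ { refl → refl }) (λ _ _ ()) (valids-unique n) (allFin⁺ n)
  ; complete = λ where
      center     → here refl
      (leaf w p) → there (∈-++⁺ˡ (∈-map⁺ leafAt (valids-complete (w , p))))
      (hub i)    → there (∈-++⁺ʳ _ (∈-hubs i))
  }

number-of-vertices : ∀ n → length (Enumeration.elements (vertices n)) ≡ 2 ^ n + n
number-of-vertices n = trans (cong suc (length-map-++-map leafAt (valids n) hub (allFin n)))
                             (cong₂ _+_ (suc-length-valids n) (length-tabulate (λ i → i)))

hubDistance : Bool → ℕ
hubDistance b = if not b then 1 else 2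

hubDistance-injective : ∀ b c → hubDistance b ≡ hubDistance c → b ≡ c
hubDistance-injective false false _ = refl
hubDistance-injective true  true  _ = refl

lookup-injective : ∀ {n} {w w′ : Vec Bool n} → (∀ i → lookup w i ≡ lookup w′ i) → w ≡ w′
lookup-injective {w = w} {w′} lookups≡ =
  trans (sym (tabulate∘lookup w)) (trans (tabulate-cong lookups≡) (tabulate∘lookup w′))

allOnes-lookup : ∀ {n} (w : Vec Bool n) → (∀ i → lookup w i ≡ true) → allOnes w ≡ true
allOnes-lookup []ᵛ       _     = refl
allOnes-lookup (b ∷ᵛ w) ones with ones fzero
... | refl = allOnes-lookup w (ones ∘ fsuc)

hubs-agree : ∀ {n} u v → adjRep (A n) (hubs n) u ≡ adjRep (A n) (hubs n) v →
             ∀ i → dist2 (A n) u (hub i) ≡ dist2 (A n) v (hub i)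
hubs-agree _ _ rep≡ i = map-cong-local⁻ rep≡ (∈-hubs i)

hubs-resolving : ∀ {n} → IsAdjResolving (A n) (hubs n)
hubs-resolving (hub i) _ rep≡ = ∈-separates (A _) (∈-hubs i) rep≡
hubs-resolving _ (hub i) rep≡ = sym (∈-separates (A _) (∈-hubs i) (sym rep≡))
hubs-resolving center center _ = refl
hubs-resolving center (leaf w p) rep≡ = ⊥-elim (subst (T ∘ not) (allOnes-lookup w (sym ∘ digit)) p)
  where
  digit : ∀ i → true ≡ lookup w i
  digit i = hubDistance-injective true _ (hubs-agree center (leaf w p) rep≡ i)
hubs-resolving (leaf w p) center rep≡ = ⊥-elim (subst (T ∘ not) (allOnes-lookup w digit) p)
  where
  digit : ∀ i → lookup w i ≡ true
  digit i = hubDistance-injective _ true (hubs-agree (leaf w p) center rep≡ i)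
hubs-resolving (leaf w p) (leaf w′ p′) rep≡ =
  cong leafAt (valid-≡ {v = w , p} {w′ , p′}
    (lookup-injective λ i → hubDistance-injective _ _ (hubs-agree (leaf w p) (leaf w′ p′) rep≡ i)))

A-isAdim : ∀ n → IsAdim (A n) n
A-isAdim n = (hubs n , hubs-unique n , hubs-resolving , length-hubs n) ,
             λ S _ resolving → 2^n+n≤m+2^m⇒n≤m (subst (_≤ length S + 2 ^ length S) (number-of-vertices n)
                                                       (size-bound (A n) (vertices n) resolving))

twin : ∀ {n} → Bool → Valid n → AV (suc n)
twin false v = leafAt (0∷ proj₁ v)
twin true  v = leafAt (1∷ v)

twin-injective : ∀ {n} {b c} {v v′ : Valid n} → twin b v ≡ twin c v′ → v ≡ v′
twin-injective {b = false} {false} refl = valid-≡ refl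
twin-injective {b = true}  {true}  refl = refl

twins-differ : ∀ {n} b (v : Valid n) → twin b v ≢ twin (not b) v
twins-differ false _ ()
twins-differ true  _ ()

hub-≢-twin : ∀ {n} {i} b (v : Valid n) → hub i ≢ twin b v
hub-≢-twin false _ ()
hub-≢-twin true  _ ()

twins-agree : ∀ {n} b (v : Valid n) x → x ≢ hub fzero → x ≢ twin b v → x ≢ twin (not b) v →
              dist2 (A (suc n)) (twin b v) x ≡ dist2 (A (suc n)) (twin (not b) v) x
twins-agree _     _ (hub fzero)     x≢u₁ _ _ = contradiction refl x≢u₁
twins-agree false _ (hub (fsuc _))  _    _ _ = refl
twins-agree true  _ (hub (fsuc _))  _    _ _ = refl
twins-agree false _ center          _    _ _ = refl
twins-agree true  _ center          _    _ _ = refl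
twins-agree false _ (leaf _ _)      _    x≢t x≢t′ =
  trans (dist2-≢ (A _) (x≢t ∘ sym)) (sym (dist2-≢ (A _) (x≢t′ ∘ sym)))
twins-agree true  _ (leaf _ _)      _    x≢t x≢t′ =
  trans (dist2-≢ (A _) (x≢t ∘ sym)) (sym (dist2-≢ (A _) (x≢t′ ∘ sym)))

2^n≤length : ∀ {n} {S : List (AV (suc n))} (e : AV (suc n)) (g : Valid n → AV (suc n)) →
             Injective _≡_ _≡_ g → (∀ v → e ≢ g v) → e ∈ S → (∀ v → g v ∈ S) → 2 ^ n ≤ length S
2^n≤length {n} {S} e g g-injective e≢g e∈S g∈S = begin
  2 ^ n                         ≡⟨ trans (cong suc (length-map g (valids n))) (suc-length-valids n) ⟨
  length (e ∷ map g (valids n)) ≤⟨ Unique-⊆⇒length≤ (∷-map⁺ g-injective e≢g (valids-unique n)) ⊆S ⟩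
  length S                      ∎
  where
  open ≤-Reasoning
  ⊆S : e ∷ map g (valids n) ⊆ S
  ⊆S (here refl) = e∈S
  ⊆S (there x∈)  with ∈-map⁻ g x∈
  ... | v , _ , refl = g∈S v

-- For n ≥ 1 the word 0…0 is not all ones, so its 1-twin is an element of S beyond the 0-twins.
2^n≤length-if-twins⊆ : ∀ n {S : List (AV (suc n))} → S ≢ [] → (∀ b v → twin b v ∈ S) → 2 ^ n ≤ length S
2^n≤length-if-twins⊆ zero    {[]}    S≢[] _ = contradiction refl S≢[]
2^n≤length-if-twins⊆ zero    {_ ∷ _} _    _ = s≤s z≤n
2^n≤length-if-twins⊆ (suc n) _ twins∈S =
  2^n≤length (twin true (0∷ replicate n false)) (twin false) (twin-injective {b = false} {false})
             (λ _ ()) (twins∈S true _) (twins∈S false)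

module _ {n} {S : List (AV (suc n))} (ft : IsFTAdjResolving (A (suc n)) S) where
  open import Data.List.Membership.DecPropositional (AV-≟ {suc n}) using (_∈?_)

  some-twin-∈ : ∀ v → ∃ λ b → twin b v ∈ S
  some-twin-∈ v with twin false v ∈? S | twin true v ∈? S
  ... | yes t∈S | _       = false , t∈S
  ... | no  _   | yes t∈S = true , t∈S
  ... | no  t∉S | no  t′∉S = ⊥-elim (ft-no-sole-separator (A (suc n)) ft (twins-differ false v) (hub fzero)
          λ x∈S x≢u₁ → twins-agree false v _ x≢u₁ (∈∧∉⇒≢ x∈S t∉S) (∈∧∉⇒≢ x∈S t′∉S))

  both-twins-∈ : hub fzero ∉ S → ∀ b v → twin b v ∈ S
  both-twins-∈ u₁∉S b v with twin b v ∈? S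
  ... | yes t∈S = t∈S
  ... | no  t∉S = ⊥-elim (ft-no-sole-separator (A (suc n)) ft (twins-differ b v) (twin (not b) v)
          λ x∈S → twins-agree b v _ (∈∧∉⇒≢ x∈S u₁∉S) (∈∧∉⇒≢ x∈S t∉S))

  2^n≤length-ftResolving : 2 ^ n ≤ length S
  2^n≤length-ftResolving with hub fzero ∈? S
  ... | yes u₁∈S = 2^n≤length (hub fzero) (λ v → twin (proj₁ (some-twin-∈ v)) v) twin-injective
                              (λ v → hub-≢-twin _ v) u₁∈S (λ v → proj₂ (some-twin-∈ v))
  ... | no  u₁∉S = 2^n≤length-if-twins⊆ n (proj₁ ft) (both-twins-∈ u₁∉S)

theorem18 : ∀ (k : ℕ) → 1 ≤ k →
    IsAdim (A k) k × Σ ℕ (λ m → IsFtadim (A k) m × 2 ^ (k ∸ 1) ≤ m)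
theorem18 (suc n) _ with ftadim-exists (A (suc n)) (vertices (suc n)) center
... | m , ftadim@((S , _ , ft , refl) , _) = A-isAdim (suc n) , m , ftadim , 2^n≤length-ftResolving ft
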